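{- For all positive integers $n$ and $p$, \[ n^p=\sum_{\ell=0}^{p-1} (-1)^{\ell}\, c_{p,\ell}\, F^{p-\ell}_n , \] where $F^{k}_n$ and $c_{p,\ell}$ are as defined in the context.
   Context: For positive integers $k,n$, the $k$-dimensional figurate number is $F^k_n=\binom{n+k-1}{k}$. Fix a positive integer $p$. The $p$-dimensional cube $C=\{(x_1,\dots,x_p)\in\mathbb{R}^p : 0\le x_i\le N \text{ for all } i\}$ (with $N>0$ fixed; the paper uses $N=n-1$) is cut into $p$-dimensional simplices $\{x\in C: x_{\sigma_1}\ge x_{\sigma_2}\ge\cdots\ge x_{\sigma_p}\}$, one for each permutation $\sigma$ of $\{1,\dots,p\}$. For $0\le \ell\le p-1$, the $(p-\ell)$-dimensional facets of these simplices are the subsets of $C$ defined by conditions of the form $x_{\sigma_1}\,L_1\,x_{\sigma_2}\,L_2\cdots L_{p-1}\,x_{\sigma_p}$, where $\sigma$ is a permutation of $\{1,\dots,p\}$ and exactly $\ell$ of the symbols $L_i$ are "$=$" and the remaining $p-1-\ell$ are "$\ge$". The number $c_{p,\ell}$ is the number of distinct such $(p-\ell)$-dimensional facets (distinct as subsets of $C$).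
   Formalization: The cube C and its facets consist only of points with rational coordinates rather than points of ℝ^p, and N is a positive rational. -}

module Defs where

open import Data.Nat as ℕ using (ℕ; zero; suc; _∸_)
open import Data.Nat.Combinatorics using (_C_)
open import Data.Integer as ℤ using (ℤ; +_)
open import Data.Rational as ℚ using (ℚ; 0ℚ)
open import Data.Bool using (Bool; true; false; if_then_else_)
open import Data.List using (List; []; _∷_; length; map; upTo; allFin; filterᵇ; foldr)
open import Data.List.Relation.Unary.All using (All)
open import Data.List.Relation.Unary.Any using (Any)
open import Data.List.Relation.Unary.AllPairs using (AllPairs)
open import Data.Fin using (Fin)
open import Data.Fin.Permutation using (Permutation′; _⟨$⟩ʳ_)
open import Data.Product using (_×_; Σ)
open import Data.Unit using (⊤)
open import Function using (id; _∘_)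
open import Function.Bundles using (_⇔_)
open import Relation.Binary.PropositionalEquality using (_≡_)
open import Relation.Nullary using (¬_)

F : ℕ → ℕ → ℕ
F k n = (n ℕ.+ k ∸ 1) C k

countTrue : List Bool → ℕ
countTrue = length ∘ filterᵇ id

-- Data of a condition  x_{σ1} L1 x_{σ2} L2 ... L_{p-1} x_{σp}
-- with L_i = "=" (true) or "≥" (false), exactly ℓ of them "=".
record FacetData (p ℓ : ℕ) : Set where
  constructor facet
  field
    σ      : Permutation′ p
    L      : List Bool
    lenL   : length L ≡ p ∸ 1
    countL : countTrue L ≡ ℓ

Chain : List ℚ → List Bool → Set
Chain (a ∷ b ∷ rest) (l ∷ ls) =
  (if l then a ≡ b else b ℚ.≤ a) × Chain (b ∷ rest) ls
Chain _ _ = ⊤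

InCube : (p : ℕ) → ℚ → (Fin p → ℚ) → Set
InCube p N x = (i : Fin p) → (0ℚ ℚ.≤ x i) × (x i ℚ.≤ N)

InFacet : {p ℓ : ℕ} → ℚ → FacetData p ℓ → (Fin p → ℚ) → Set
InFacet {p} N d x =
  InCube p N x × Chain (map (λ i → x (FacetData.σ d ⟨$⟩ʳ i)) (allFin p)) (FacetData.L d)

SameFacet : {p ℓ : ℕ} → ℚ → FacetData p ℓ → FacetData p ℓ → Set
SameFacet {p} N d e = (x : Fin p → ℚ) → InFacet N d x ⇔ InFacet N e x

-- c is the number of distinct (p-ℓ)-dimensional facets (as subsets of C):
-- there is a list of c facet data defining pairwise distinct subsets,
-- such that every facet datum defines the same subset as one in the list.
IsFacetCount : ℚ → (p ℓ : ℕ) → ℕ → Set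
IsFacetCount N p ℓ c =
  Σ (List (FacetData p ℓ)) λ ds →
    (length ds ≡ c)
    × AllPairs (λ d e → ¬ SameFacet N d e) ds
    × ((d : FacetData p ℓ) → Any (SameFacet N d) ds)

altSum : (c : ℕ → ℕ) → (n p : ℕ) → ℤ
altSum c n p =
  foldr ℤ._+_ (+ 0) (map (λ ℓ → (ℤ.- ℤ.1ℤ) ℤ.^ ℓ ℤ.* + (c ℓ ℕ.* F (p ∸ ℓ) n)) (upTo p))

module Submission where

-- Its code sends each coordinate to the index of its block (maximal run joined
-- by "="); the chain condition says exactly that x is antitone along the code.
-- Hence data with equal codes define the same facet, and conversely (for N > 0)
-- test points that are 0 or N show that the facet determines its code.  Codes
-- are precisely the surjections onto p - ℓ blocks, i.e. ordered set partitions.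
--
-- We list one datum for each such surjection, building the data on m + 2
-- coordinates from those on m + 1 by inserting the new coordinate 0 into an
-- existing block or as a new block.  This list witnesses IsFacetCount, and any
-- two lists of class representatives have the same length.  Writing c(m, ℓ) for
-- the number of facets with ℓ equalities on m + 1 coordinates, the lengths obey
--   c(m+1, ℓ) = (m+2-ℓ) (c(m, ℓ-1) + c(m, ℓ)),   c(m, m+1) = 0,   c(0, 0) = 1.
-- Finally, for any table obeying this recurrence, the identity follows by
-- induction on p: multiplying by n, the absorption identity for binomials
-- turns each term into a difference, and summation by parts yields the next row.

open import Defs
open import Data.Nat using (ℕ; _<_; _^_)
open import Data.Integer using (+_)
open import Data.Rational using (ℚ; 0ℚ) renaming (_<_ to _<ℚ_)
open import Data.Product using (_×_; Σ)
open import Relation.Binary.PropositionalEquality using (_≡_)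

open import Data.Nat using (zero; suc; _+_; _*_; _∸_; _≤_; z≤n; s≤s; _≤?_; _<?_; _≟_)
import Data.Nat.Properties as ℕₚ
open import Data.Nat.Combinatorics using (_C_; nC1≡n; nCk+nC[k+1]≡[n+1]C[k+1])
open import Data.Integer as ℤ using (ℤ)
import Data.Integer.Properties as ℤₚ
open import Data.Integer.Tactic.RingSolver using (solve-∀)
open import Data.Rational using () renaming (_≤_ to _≤ℚ_)
import Data.Rational.Properties as ℚₚ
open import Data.Bool using (Bool; true; false; if_then_else_)
open import Data.List using (List; []; _∷_; _++_; length; lookup; map; allFin; tabulate; applyUpTo; foldr)
import Data.List.Properties as Listₚ
open import Data.List.Relation.Unary.All as All using (All; []; _∷_)
import Data.List.Relation.Unary.All.Properties as Allₚ
open import Data.List.Relation.Unary.Any as Any using (Any; here; there)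
import Data.List.Relation.Unary.Any.Properties as Anyₚ
open import Data.List.Relation.Unary.AllPairs as AllPairs using (AllPairs; []; _∷_)
import Data.List.Relation.Unary.AllPairs.Properties as AllPairsₚ
open import Data.Fin using (Fin; toℕ; fromℕ<; punchIn)
import Data.Fin.Properties as Finₚ
open import Data.Fin.Permutation using (Permutation′; _⟨$⟩ʳ_; _⟨$⟩ˡ_; inverseˡ; inverseʳ; insert) renaming (id to idPerm)
open import Data.Product using (_,_; proj₁; proj₂; ∃)
open import Data.Unit using (⊤; tt)
open import Data.Empty using (⊥-elim)
open import Function using (_∘_)
open import Function.Bundles using (_⇔_; mk⇔; Equivalence)
open import Relation.Binary.Definitions using (tri<; tri≈; tri>)
open import Relation.Binary.PropositionalEquality using (module ≡-Reasoning; _≢_; refl; sym; trans; cong; cong₂; subst; subst₂)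
open import Relation.Nullary using (¬_; Dec; yes; no)

geCount : Bool → ℕ
geCount true  = 0
geCount false = 1

eqCount : Bool → ℕ
eqCount true  = 1
eqCount false = 0

-- block L s: index of the block (maximal run of terms joined by "=") that
-- contains the s-th term of a chain a₀ L₁ a₁ L₂ …, i.e. the number of "≥"
-- among the first s symbols of L.
block : List Bool → ℕ → ℕ
block L       zero    = 0
block []      (suc s) = 0
block (b ∷ L) (suc s) = geCount b + block L s

Antitone : {k : ℕ} → (Fin k → ℕ) → (Fin k → ℚ) → Set
Antitone w x = ∀ i j → w i ≤ w j → x j ≤ℚ x i

relation⇒≥ : ∀ (l : Bool) {x y : ℚ} → (if l then x ≡ y else y ≤ℚ x) → y ≤ℚ x
relation⇒≥ true  refl = ℚₚ.≤-refl
relation⇒≥ false y≤x  = y≤x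

chain⇔antitone : ∀ (L : List Bool) (h : Fin (suc (length L)) → ℚ) →
  Chain (tabulate h) L ⇔ Antitone (block L ∘ toℕ) h
chain⇔antitone L h = mk⇔ (chain⇒antitone L h) (antitone⇒chain L h)
  where
  chain⇒antitone : ∀ L (h : Fin (suc (length L)) → ℚ) →
    Chain (tabulate h) L → Antitone (block L ∘ toℕ) h
  chain⇒antitone []          h _       Fin.zero    Fin.zero    _  = ℚₚ.≤-refl
  chain⇒antitone (l ∷ L)     h (r , c) Fin.zero    Fin.zero    _  = ℚₚ.≤-refl
  chain⇒antitone (l ∷ L)     h (r , c) Fin.zero    (Fin.suc b) _  =
    ℚₚ.≤-trans (chain⇒antitone L (h ∘ Fin.suc) c Fin.zero b z≤n) (relation⇒≥ l r)
  chain⇒antitone (true ∷ L)  h (r , c) (Fin.suc a) Fin.zero    le =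
    subst (_≤ℚ h (Fin.suc a)) (sym r) (chain⇒antitone L (h ∘ Fin.suc) c a Fin.zero le)
  chain⇒antitone (false ∷ L) h (r , c) (Fin.suc a) Fin.zero    ()
  chain⇒antitone (l ∷ L)     h (r , c) (Fin.suc a) (Fin.suc b) le =
    chain⇒antitone L (h ∘ Fin.suc) c a b (ℕₚ.+-cancelˡ-≤ (geCount l) _ _ le)

  antitone⇒chain : ∀ L (h : Fin (suc (length L)) → ℚ) →
    Antitone (block L ∘ toℕ) h → Chain (tabulate h) L
  antitone⇒chain []         h anti = tt
  antitone⇒chain (true ∷ L) h anti =
    ℚₚ.≤-antisym (anti (Fin.suc Fin.zero) Fin.zero z≤n) (anti Fin.zero (Fin.suc Fin.zero) z≤n) ,
    antitone⇒chain L (h ∘ Fin.suc) (λ a b → anti (Fin.suc a) (Fin.suc b))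
  antitone⇒chain (false ∷ L) h anti =
    anti Fin.zero (Fin.suc Fin.zero) z≤n ,
    antitone⇒chain L (h ∘ Fin.suc) (λ a b le → anti (Fin.suc a) (Fin.suc b) (s≤s le))

antitone-∘-perm : ∀ {k} (π : Permutation′ k) (w : Fin k → ℕ) (x : Fin k → ℚ) →
  Antitone w (x ∘ (π ⟨$⟩ʳ_)) ⇔ Antitone (w ∘ (π ⟨$⟩ˡ_)) x
antitone-∘-perm π w x = mk⇔
  (λ anti i j le → subst₂ _≤ℚ_ (cong x (inverseʳ π)) (cong x (inverseʳ π))
                     (anti (π ⟨$⟩ˡ i) (π ⟨$⟩ˡ j) le))
  (λ anti a b le → anti (π ⟨$⟩ʳ a) (π ⟨$⟩ʳ b)
                     (subst₂ (λ u v → w u ≤ w v) (sym (inverseˡ π)) (sym (inverseˡ π)) le))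

-- The code of a facet datum d = (σ, L): coordinate i stands at position σ⁻¹ i
-- of the chain x_{σ 0} L₁ x_{σ 1} …, hence in block `code d i`.
code : ∀ {p ℓ} → FacetData p ℓ → Fin p → ℕ
code d i = block (FacetData.L d) (toℕ (FacetData.σ d ⟨$⟩ˡ i))

inFacet⇔ : ∀ {m ℓ} (N : ℚ) (d : FacetData (suc m) ℓ) (x : Fin (suc m) → ℚ) →
  InFacet N d x ⇔ (InCube (suc m) N x × Antitone (code d) x)
inFacet⇔ N (facet σ L refl _) x = mk⇔
  (λ (cube , ch) → cube , Equivalence.to (antitone-∘-perm σ _ x)
                             (Equivalence.to (chain⇔antitone L _) (subst (λ z → Chain z L) map≡tabulate ch)))
  (λ (cube , anti) → cube , subst (λ z → Chain z L) (sym map≡tabulate)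
                               (Equivalence.from (chain⇔antitone L _)
                                 (Equivalence.from (antitone-∘-perm σ _ x) anti)))
  where
  map≡tabulate : map (λ i → x (σ ⟨$⟩ʳ i)) (allFin _) ≡ tabulate (λ i → x (σ ⟨$⟩ʳ i))
  map≡tabulate = Listₚ.map-tabulate (λ i → i) _

sameCode⇒sameFacet : ∀ {m ℓ} (N : ℚ) (d e : FacetData (suc m) ℓ) →
  (∀ i → code d i ≡ code e i) → SameFacet N d e
sameCode⇒sameFacet N d e eq x = mk⇔
  (λ inD → let (cube , anti) = Equivalence.to (inFacet⇔ N d x) inD in
     Equivalence.from (inFacet⇔ N e x) (cube , λ i j le → anti i j (subst₂ _≤_ (sym (eq i)) (sym (eq j)) le)))
  (λ inE → let (cube , anti) = Equivalence.to (inFacet⇔ N e x) inE in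
     Equivalence.from (inFacet⇔ N d x) (cube , λ i j le → anti i j (subst₂ _≤_ (eq i) (eq j) le)))

DownClosed : {A : Set} → (A → ℕ) → Set
DownClosed f = ∀ i v → v < f i → ∃ λ j → f j ≡ v

-- If f is downward closed and the preorder induced by g refines the one induced
-- by f, then f ≤ g pointwise.  (By induction on the value f i: a witness j of
-- f i ∸ 1 must have g j < g i.)
downClosed-refinement⇒≤ : ∀ {A : Set} (f g : A → ℕ) → DownClosed f →
  (∀ i j → g i ≤ g j → f i ≤ f j) → ∀ i → f i ≤ g i
downClosed-refinement⇒≤ f g closed refines i = byValue (f i) i refl
  where
  byValue : ∀ v i → f i ≡ v → f i ≤ g i
  byValue zero    i fi≡0 = subst (_≤ g i) (sym fi≡0) z≤n
  byValue (suc v) i fi≡1+v with closed i v (subst (v <_) (sym fi≡1+v) ℕₚ.≤-refl)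
  ... | j , fj≡v with g i ≤? g j
  ...   | yes gi≤gj = ⊥-elim (ℕₚ.<-irrefl refl
            (subst₂ _≤_ fi≡1+v fj≡v (refines i j gi≤gj)))
  ...   | no  gi≰gj = subst (_≤ g i) (sym fi≡1+v)
            (ℕₚ.≤-trans (s≤s (subst (_≤ g j) fj≡v (byValue v j fj≡v))) (ℕₚ.≰⇒> gi≰gj))

module TestPoints {N : ℚ} (N>0 : 0ℚ <ℚ N) where

  indicator : ∀ {P : Set} → Dec P → ℚ
  indicator (yes _) = N
  indicator (no _)  = 0ℚ

  lowerSet : ∀ {k} → (Fin k → ℕ) → ℕ → Fin k → ℚ
  lowerSet w t i = indicator (w i <? t)

  lowerSet-inCube : ∀ {k} (w : Fin k → ℕ) t → InCube k N (lowerSet w t)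
  lowerSet-inCube w t i with w i <? t
  ... | yes _ = ℚₚ.<⇒≤ N>0 , ℚₚ.≤-refl
  ... | no _  = ℚₚ.≤-refl , ℚₚ.<⇒≤ N>0

  lowerSet-antitone : ∀ {k} (w : Fin k → ℕ) t → Antitone w (lowerSet w t)
  lowerSet-antitone w t i j wi≤wj with w j <? t | w i <? t
  ... | yes _    | yes _    = ℚₚ.≤-refl
  ... | yes wj<t | no  wi≮t = ⊥-elim (wi≮t (ℕₚ.≤-<-trans wi≤wj wj<t))
  ... | no  _    | yes _    = ℚₚ.<⇒≤ N>0
  ... | no  _    | no  _    = ℚₚ.≤-refl

  lowerSet-detects : ∀ {k} (w : Fin k → ℕ) i j →
    lowerSet w (suc (w j)) j ≤ℚ lowerSet w (suc (w j)) i → w i ≤ w j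
  lowerSet-detects w i j le with w j <? suc (w j) | w i <? suc (w j)
  ... | _        | yes (s≤s wi≤wj) = wi≤wj
  ... | yes _    | no  _           = ⊥-elim (ℚₚ.<-irrefl refl (ℚₚ.<-≤-trans N>0 le))
  ... | no  wj≮  | no  _           = ⊥-elim (wj≮ ℕₚ.≤-refl)

  sameFacet⇒refinement : ∀ {m ℓ} (d e : FacetData (suc m) ℓ) → SameFacet N d e →
    ∀ i j → code e i ≤ code e j → code d i ≤ code d j
  sameFacet⇒refinement d e same i j le = lowerSet-detects (code d) i j (antiE i j le)
    where
    x = lowerSet (code d) (suc (code d j))
    antiE : Antitone (code e) x
    antiE = proj₂ (Equivalence.to (inFacet⇔ N e x)
              (Equivalence.to (same x)
                (Equivalence.from (inFacet⇔ N d x)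
                  (lowerSet-inCube (code d) (suc (code d j)) , lowerSet-antitone (code d) (suc (code d j))))))

sameFacet-sym : ∀ {p ℓ} {N : ℚ} {d e : FacetData p ℓ} → SameFacet N d e → SameFacet N e d
sameFacet-sym same x = mk⇔ (Equivalence.from (same x)) (Equivalence.to (same x))

sameFacet-trans : ∀ {p ℓ} {N : ℚ} {d e f : FacetData p ℓ} →
  SameFacet N d e → SameFacet N e f → SameFacet N d f
sameFacet-trans de ef x = mk⇔ (Equivalence.to (ef x) ∘ Equivalence.to (de x))
                              (Equivalence.from (de x) ∘ Equivalence.from (ef x))

block-step : ∀ L s → block L (suc s) ≤ suc (block L s)
block-step []          s       = z≤n
block-step (true ∷ L)  zero    = z≤n
block-step (false ∷ L) zero    = ℕₚ.≤-refl
block-step (b ∷ L)     (suc s) =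
  ℕₚ.≤-trans (ℕₚ.+-monoʳ-≤ (geCount b) (block-step L s)) (ℕₚ.≤-reflexive (ℕₚ.+-suc (geCount b) (block L s)))

block-mono : ∀ L {s t} → s ≤ t → block L s ≤ block L t
block-mono L       {zero}            _         = z≤n
block-mono []      {suc s} {suc t}   _         = z≤n
block-mono (b ∷ L) {suc s} {suc t}   (s≤s s≤t) = ℕₚ.+-monoʳ-≤ (geCount b) (block-mono L s≤t)

intermediate : (f : ℕ → ℕ) → f 0 ≡ 0 → (∀ s → f (suc s) ≤ suc (f s)) →
  ∀ s v → v ≤ f s → ∃ λ s' → s' ≤ s × f s' ≡ v
intermediate f f0≡0 step zero v v≤f0 =
  zero , z≤n , trans f0≡0 (sym (ℕₚ.n≤0⇒n≡0 (subst (v ≤_) f0≡0 v≤f0)))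
intermediate f f0≡0 step (suc s) v v≤ with v ≤? f s
... | yes v≤fs = let (s' , s'≤s , fs'≡v) = intermediate f f0≡0 step s v v≤fs
                 in s' , ℕₚ.m≤n⇒m≤1+n s'≤s , fs'≡v
... | no  v≰fs = suc s , ℕₚ.≤-refl , ℕₚ.≤-antisym (ℕₚ.≤-trans (step s) (ℕₚ.≰⇒> v≰fs)) v≤

lastBlock+eqs : ∀ L → block L (length L) + countTrue L ≡ length L
lastBlock+eqs []          = refl
lastBlock+eqs (true ∷ L)  = trans (ℕₚ.+-suc (block L (length L)) (countTrue L)) (cong suc (lastBlock+eqs L))
lastBlock+eqs (false ∷ L) = cong suc (lastBlock+eqs L)

lastBlock : ∀ {m ℓ} → FacetData (suc m) ℓ → ℕ
lastBlock {m} d = block (FacetData.L d) m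

lastBlock+ℓ : ∀ {m ℓ} (d : FacetData (suc m) ℓ) → lastBlock d + ℓ ≡ m
lastBlock+ℓ (facet σ L refl refl) = lastBlock+eqs L

blockCount : ∀ {m ℓ} (d : FacetData (suc m) ℓ) → suc m ∸ ℓ ≡ suc (lastBlock d)
blockCount {m} {ℓ} d =
  trans (cong (λ z → suc z ∸ ℓ) (sym (lastBlock+ℓ d))) (ℕₚ.m+n∸n≡m (suc (lastBlock d)) ℓ)

IsSurjOnto : ∀ {k} → ℕ → (Fin k → ℕ) → Set
IsSurjOnto K w = (∀ i → w i < K) × (∀ v → v < K → ∃ λ i → w i ≡ v)

surjOnto⇒downClosed : ∀ {k K} (w : Fin k → ℕ) → IsSurjOnto K w → DownClosed w
surjOnto⇒downClosed w (bounded , onto) i v v<wi = onto v (ℕₚ.<-trans v<wi (bounded i))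

code-surjOnto : ∀ {m ℓ} (d : FacetData (suc m) ℓ) → IsSurjOnto (suc m ∸ ℓ) (code d)
code-surjOnto {m} d rewrite blockCount d = bounded d , onto d
  where
  bounded : ∀ (d : FacetData (suc m) _) i → code d i < suc (lastBlock d)
  bounded (facet σ L refl _) i = s≤s (block-mono L (ℕₚ.≤-pred (Finₚ.toℕ<n (σ ⟨$⟩ˡ i))))
  onto : ∀ (d : FacetData (suc m) _) v → v < suc (lastBlock d) → ∃ λ i → code d i ≡ v
  onto (facet σ L refl _) v (s≤s v≤last) =
    let (s , s≤m , blockₛ≡v) = intermediate (block L) refl (block-step L) (length L) v v≤last
        s<1+m = s≤s s≤m
    in σ ⟨$⟩ʳ fromℕ< s<1+m ,
       trans (cong (block L ∘ toℕ) (inverseˡ σ)) (trans (cong (block L) (Finₚ.toℕ-fromℕ< s<1+m)) blockₛ≡v)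

-- Conversely, for N > 0 equal facets have equal codes: each code order refines
-- the other, and codes are downward closed.
sameFacet⇒sameCode : ∀ {m ℓ} {N : ℚ} → 0ℚ <ℚ N → (d e : FacetData (suc m) ℓ) →
  SameFacet N d e → ∀ i → code d i ≡ code e i
sameFacet⇒sameCode {m} {ℓ} N>0 d e same i = ℕₚ.≤-antisym
  (downClosed-refinement⇒≤ (code d) (code e) (closed d) (sameFacet⇒refinement d e same) i)
  (downClosed-refinement⇒≤ (code e) (code d) (closed e) (sameFacet⇒refinement e d (sameFacet-sym {d = d} {e = e} same)) i)
  where
  open TestPoints N>0
  closed : (f : FacetData (suc m) ℓ) → DownClosed (code f)
  closed f = surjOnto⇒downClosed (code f) (code-surjOnto f)

insertAt : ℕ → Bool → List Bool → List Bool
insertAt zero    b L       = b ∷ L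
insertAt (suc n) b []      = b ∷ []
insertAt (suc n) b (c ∷ L) = c ∷ insertAt n b L

length-insertAt : ∀ n b L → length (insertAt n b L) ≡ suc (length L)
length-insertAt zero    b L       = refl
length-insertAt (suc n) b []      = refl
length-insertAt (suc n) b (c ∷ L) = cong suc (length-insertAt n b L)

countTrue-insertAt : ∀ n b L → countTrue (insertAt n b L) ≡ eqCount b + countTrue L
countTrue-insertAt zero    true  L           = refl
countTrue-insertAt zero    false L           = refl
countTrue-insertAt (suc n) true  []          = refl
countTrue-insertAt (suc n) false []          = refl
countTrue-insertAt (suc n) b     (true ∷ L)  =
  trans (cong suc (countTrue-insertAt n b L)) (sym (ℕₚ.+-suc (eqCount b) (countTrue L)))
countTrue-insertAt (suc n) b     (false ∷ L) = countTrue-insertAt n b L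

block-insertAt-≤ : ∀ n b L s → s ≤ n → s ≤ length L → block (insertAt n b L) s ≡ block L s
block-insertAt-≤ n       b L       zero    _         _          = refl
block-insertAt-≤ (suc n) b (c ∷ L) (suc s) (s≤s s≤n) (s≤s s≤len) =
  cong (λ z → geCount c + z) (block-insertAt-≤ n b L s s≤n s≤len)

block-insertAt-≥ : ∀ n b L s → n ≤ s → n ≤ length L →
  block (insertAt n b L) (suc s) ≡ geCount b + block L s
block-insertAt-≥ zero    b L       s       _         _          = refl
block-insertAt-≥ (suc n) b (c ∷ L) (suc s) (s≤s n≤s) (s≤s n≤len) = begin
  geCount c + block (insertAt n b L) (suc s) ≡⟨ cong (λ z → geCount c + z) (block-insertAt-≥ n b L s n≤s n≤len) ⟩
  geCount c + (geCount b + block L s)       ≡⟨ ℕₚ.+-assoc (geCount c) (geCount b) (block L s) ⟨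
  (geCount c + geCount b) + block L s       ≡⟨ cong (λ z → z + block L s) (ℕₚ.+-comm (geCount c) (geCount b)) ⟩
  (geCount b + geCount c) + block L s       ≡⟨ ℕₚ.+-assoc (geCount b) (geCount c) (block L s) ⟩
  geCount b + (geCount c + block L s)       ∎
  where open ≡-Reasoning

-- blockStart L a: the first position of the chain lying in block a
-- (one past the last position if a is one past the last block).
blockStart : List Bool → ℕ → ℕ
blockStart L           zero    = zero
blockStart []          (suc a) = 1
blockStart (true ∷ L)  (suc a) = suc (blockStart L (suc a))
blockStart (false ∷ L) (suc a) = suc (blockStart L a)

blockStart-bound : ∀ L a → blockStart L a ≤ suc (length L)
blockStart-bound L           zero    = z≤n
blockStart-bound []          (suc a) = ℕₚ.≤-refl
blockStart-bound (true ∷ L)  (suc a) = s≤s (blockStart-bound L (suc a))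
blockStart-bound (false ∷ L) (suc a) = s≤s (blockStart-bound L a)

before-blockStart : ∀ L a s → s ≤ length L → s < blockStart L a ⇔ block L s < a
before-blockStart L a s s≤len = mk⇔ (⇒ L a s s≤len) (⇐ L a s s≤len)
  where
  ⇒ : ∀ L a s → s ≤ length L → s < blockStart L a → block L s < a
  ⇒ L           (suc a) zero    _           _         = s≤s z≤n
  ⇒ (true ∷ L)  (suc a) (suc s) (s≤s s≤len) (s≤s s<q) = ⇒ L (suc a) s s≤len s<q
  ⇒ (false ∷ L) (suc a) (suc s) (s≤s s≤len) (s≤s s<q) = s≤s (⇒ L a s s≤len s<q)
  ⇐ : ∀ L a s → s ≤ length L → block L s < a → s < blockStart L a
  ⇐ []          (suc a) zero    _           _         = s≤s z≤n
  ⇐ (true ∷ L)  (suc a) zero    _           _         = s≤s z≤n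
  ⇐ (false ∷ L) (suc a) zero    _           _         = s≤s z≤n
  ⇐ (true ∷ L)  (suc a) (suc s) (s≤s s≤len) b<a       = s≤s (⇐ L (suc a) s s≤len b<a)
  ⇐ (false ∷ L) (suc a) (suc s) (s≤s s≤len) (s≤s b<a) = s≤s (⇐ L a s s≤len b<a)

block-insertAt-blockStart : ∀ b L a → a ≤ geCount b + block L (length L) →
  block (insertAt (blockStart L a) b L) (blockStart L a) ≡ a
block-insertAt-blockStart b     L           zero    _ = refl
block-insertAt-blockStart true  []          (suc a) ()
block-insertAt-blockStart false []          (suc zero) _ = refl
block-insertAt-blockStart false []          (suc (suc a)) (s≤s ())
block-insertAt-blockStart b     (true ∷ L)  (suc a) a≤ = block-insertAt-blockStart b L (suc a) a≤
block-insertAt-blockStart b     (false ∷ L) (suc a) a≤ =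
  cong suc (block-insertAt-blockStart b L a
    (ℕₚ.≤-pred (subst (suc a ≤_) (ℕₚ.+-suc (geCount b) (block L (length L))) a≤)))

toℕ-punchIn-below : ∀ {n} (q : Fin (suc n)) (j : Fin n) → toℕ j < toℕ q → toℕ (punchIn q j) ≡ toℕ j
toℕ-punchIn-below (Fin.suc q) Fin.zero    _         = refl
toℕ-punchIn-below (Fin.suc q) (Fin.suc j) (s≤s j<q) = cong suc (toℕ-punchIn-below q j j<q)

toℕ-punchIn-above : ∀ {n} (q : Fin (suc n)) (j : Fin n) → toℕ q ≤ toℕ j → toℕ (punchIn q j) ≡ suc (toℕ j)
toℕ-punchIn-above Fin.zero    j           _         = refl
toℕ-punchIn-above (Fin.suc q) (Fin.suc j) (s≤s q≤j) = cong suc (toℕ-punchIn-above q j q≤j)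

-- Relabelling of the old blocks when a term followed by b is inserted at the
-- start of block a: blocks from a on move up by the contribution of b.
relabel : Bool → ℕ → ℕ → ℕ
relabel b a v with v <? a
... | yes _ = v
... | no  _ = geCount b + v

relabel-below : ∀ b a v → v < a → relabel b a v ≡ v
relabel-below b a v v<a with v <? a
... | yes _   = refl
... | no  v≮a = ⊥-elim (v≮a v<a)

relabel-above : ∀ b a v → ¬ v < a → relabel b a v ≡ geCount b + v
relabel-above b a v v≮a with v <? a
... | yes v<a = ⊥-elim (v≮a v<a)
... | no  _   = refl

relabel-true : ∀ a v → relabel true a v ≡ v
relabel-true a v with v <? a
... | yes _ = refl
... | no  _ = refl

relabel-false-≢ : ∀ a v → relabel false a v ≢ a
relabel-false-≢ a v eq with v <? a
... | yes v<a = ℕₚ.<-irrefl eq v<a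
... | no  v≮a = v≮a (subst (v <_) eq ℕₚ.≤-refl)

relabel-injective : ∀ b a u v → relabel b a u ≡ relabel b a v → u ≡ v
relabel-injective b a u v eq with u <? a | v <? a
... | yes _   | yes _   = eq
... | yes u<a | no  v≮a = ⊥-elim (v≮a (ℕₚ.≤-<-trans (ℕₚ.m≤n+m v (geCount b)) (subst (_< a) eq u<a)))
... | no  u≮a | yes v<a = ⊥-elim (u≮a (ℕₚ.≤-<-trans (ℕₚ.m≤n+m u (geCount b)) (subst (_< a) (sym eq) v<a)))
... | no  _   | no  _   = ℕₚ.+-cancelˡ-≡ (geCount b) u v eq

-- The inverse of the relabelling for a new block a, away from a.
unrelabel : ℕ → ℕ → ℕ
unrelabel a v with v <? a
... | yes _ = v
... | no  _ = v ∸ 1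

unrelabel-below : ∀ a v → v < a → unrelabel a v ≡ v
unrelabel-below a v v<a with v <? a
... | yes _   = refl
... | no  v≮a = ⊥-elim (v≮a v<a)

unrelabel-above : ∀ a v → ¬ v < a → unrelabel a v ≡ v ∸ 1
unrelabel-above a v v≮a with v <? a
... | yes v<a = ⊥-elim (v≮a v<a)
... | no  _   = refl

relabel-unrelabel : ∀ a v → v ≢ a → relabel false a (unrelabel a v) ≡ v
relabel-unrelabel a v v≢a with v <? a
... | yes v<a = relabel-below false a v v<a
relabel-unrelabel a zero    v≢a | no v≮a = ⊥-elim (v≢a (sym (ℕₚ.n≤0⇒n≡0 (ℕₚ.≮⇒≥ v≮a))))
relabel-unrelabel a (suc v) v≢a | no v≮a =
  relabel-above false a v (λ v<a → v≢a (ℕₚ.≤-antisym v<a (ℕₚ.≮⇒≥ v≮a)))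

blockStartFin : ∀ {m} (L : List Bool) → length L ≡ m → ℕ → Fin (suc (suc m))
blockStartFin L refl a = fromℕ< (s≤s (blockStart-bound L a))

toℕ-blockStartFin : ∀ {m} L (len≡m : length L ≡ m) a → toℕ (blockStartFin L len≡m a) ≡ blockStart L a
toℕ-blockStartFin L refl a = Finₚ.toℕ-fromℕ< (s≤s (blockStart-bound L a))

-- extend b a d: add a new coordinate 0 to the datum d (whose coordinates are
-- shifted by one) and put it at the start of block a, followed by the symbol b.
extend : ∀ {m ℓ} (b : Bool) → ℕ → FacetData (suc m) ℓ → FacetData (suc (suc m)) (eqCount b + ℓ)
extend b a (facet σ L lenL countL) =
  facet (insert (blockStartFin L lenL a) Fin.zero σ) (insertAt (blockStart L a) b L)
        (trans (length-insertAt (blockStart L a) b L) (cong suc lenL))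
        (trans (countTrue-insertAt (blockStart L a) b L) (cong (λ z → eqCount b + z) countL))

code-extend-zero : ∀ {m ℓ} b a (d : FacetData (suc m) ℓ) → a ≤ geCount b + lastBlock d →
  code (extend b a d) Fin.zero ≡ a
code-extend-zero b a (facet σ L refl _) a≤ =
  trans (cong (block (insertAt (blockStart L a) b L)) (toℕ-blockStartFin L refl a))
        (block-insertAt-blockStart b L a a≤)

code-extend-suc : ∀ {m ℓ} b a (d : FacetData (suc m) ℓ) c →
  code (extend b a d) (Fin.suc c) ≡ relabel b a (code d c)
code-extend-suc b a (facet σ L refl _) c = moved (σ ⟨$⟩ˡ c)
  where
  open ≡-Reasoning
  L′ = insertAt (blockStart L a) b L
  q  = blockStartFin L refl a
  moved : (j : Fin (suc (length L))) →
    block L′ (toℕ (punchIn q j)) ≡ relabel b a (block L (toℕ j))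
  moved j with toℕ j <? blockStart L a
  ... | yes s<q = begin
    block L′ (toℕ (punchIn q j)) ≡⟨ cong (block L′) (toℕ-punchIn-below q j (subst (_ <_) (sym (toℕ-blockStartFin L refl a)) s<q)) ⟩
    block L′ (toℕ j)             ≡⟨ block-insertAt-≤ (blockStart L a) b L (toℕ j) (ℕₚ.<⇒≤ s<q) s≤m ⟩
    block L (toℕ j)              ≡⟨ relabel-below b a _ (Equivalence.to (before-blockStart L a (toℕ j) s≤m) s<q) ⟨
    relabel b a (block L (toℕ j)) ∎
    where s≤m = ℕₚ.≤-pred (Finₚ.toℕ<n j)
  ... | no s≮q = begin
    block L′ (toℕ (punchIn q j)) ≡⟨ cong (block L′) (toℕ-punchIn-above q j (subst (_≤ _) (sym (toℕ-blockStartFin L refl a)) q≤s)) ⟩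
    block L′ (suc (toℕ j))       ≡⟨ block-insertAt-≥ (blockStart L a) b L (toℕ j) q≤s (ℕₚ.≤-trans q≤s s≤m) ⟩
    geCount b + block L (toℕ j)  ≡⟨ relabel-above b a _ (s≮q ∘ Equivalence.from (before-blockStart L a (toℕ j) s≤m)) ⟨
    relabel b a (block L (toℕ j)) ∎
    where
    s≤m = ℕₚ.≤-pred (Finₚ.toℕ<n j)
    q≤s = ℕₚ.≮⇒≥ s≮q

gridMap : {A B : Set} → (ℕ → A → B) → ℕ → List A → List B
gridMap f K []       = []
gridMap f K (d ∷ ds) = applyUpTo (λ a → f a d) K ++ gridMap f K ds

length-gridMap : ∀ {A B : Set} (f : ℕ → A → B) K ds → length (gridMap f K ds) ≡ K * length ds
length-gridMap f K []       = sym (ℕₚ.*-zeroʳ K)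
length-gridMap f K (d ∷ ds) = begin
  length (applyUpTo (λ a → f a d) K ++ gridMap f K ds) ≡⟨ Listₚ.length-++ (applyUpTo (λ a → f a d) K) ⟩
  length (applyUpTo (λ a → f a d) K) + length (gridMap f K ds)
    ≡⟨ cong₂ _+_ (Listₚ.length-applyUpTo (λ a → f a d) K) (length-gridMap f K ds) ⟩
  K + K * length ds                                     ≡⟨ ℕₚ.*-suc K (length ds) ⟨
  K * suc (length ds)                                   ∎
  where open ≡-Reasoning

gridMap-any : ∀ {A B : Set} {P : B → Set} (f : ℕ → A → B) K ds →
  Any (λ d → ∃ λ a → a < K × P (f a d)) ds → Any P (gridMap f K ds)
gridMap-any f K (d ∷ ds) (here (a , a<K , p)) = Anyₚ.++⁺ˡ (Anyₚ.applyUpTo⁺ (λ a → f a d) p a<K)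
gridMap-any f K (d ∷ ds) (there any)          = Anyₚ.++⁺ʳ (applyUpTo (λ a → f a d) K) (gridMap-any f K ds any)

gridMap-all : ∀ {A B : Set} {Q : A → Set} {P : B → Set} (f : ℕ → A → B) K ds →
  All Q ds → (∀ d → Q d → ∀ a → a < K → P (f a d)) → All P (gridMap f K ds)
gridMap-all f K []       []       h = []
gridMap-all f K (d ∷ ds) (q ∷ qs) h =
  Allₚ.++⁺ (Allₚ.applyUpTo⁺₁ _ K (h d q _)) (gridMap-all f K ds qs h)

gridMap-allPairs : ∀ {A B : Set} {R : A → A → Set} {S : B → B → Set} (f : ℕ → A → B) K ds →
  AllPairs R ds →
  (∀ d a b → a < b → b < K → S (f a d) (f b d)) →
  (∀ d e → R d e → ∀ a b → a < K → b < K → S (f a d) (f b e)) →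
  AllPairs S (gridMap f K ds)
gridMap-allPairs f K []       []       same cross = []
gridMap-allPairs f K (d ∷ ds) (r ∷ rs) same cross =
  AllPairsₚ.++⁺ (AllPairsₚ.applyUpTo⁺₁ _ K (same d _ _))
    (gridMap-allPairs f K ds rs same cross)
    (Allₚ.applyUpTo⁺₁ _ K (λ a<K → gridMap-all f K ds r (λ e rde b b<K → cross d e rde _ b a<K b<K)))

-- All extensions of the data in ds by a new coordinate following the symbol b;
-- a ranges over the blocks of the extended datum.
extensions : ∀ {m ℓ} (b : Bool) → List (FacetData (suc m) ℓ) →
  List (FacetData (suc (suc m)) (eqCount b + ℓ))
extensions {m} {ℓ} b = gridMap (extend b) (suc (suc m) ∸ (eqCount b + ℓ))

extension-block-bound : ∀ {m ℓ} b (d : FacetData (suc m) ℓ) a →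
  a < suc (suc m) ∸ (eqCount b + ℓ) → a ≤ geCount b + lastBlock d
extension-block-bound true  d a a<K = ℕₚ.≤-pred (subst (a <_) (blockCount d) a<K)
extension-block-bound {m} {ℓ} false d a a<K =
  ℕₚ.≤-pred (subst (a <_) (trans (ℕₚ.+-∸-assoc 1 ℓ≤1+m) (cong suc (blockCount d))) a<K)
  where
  ℓ≤1+m : ℓ ≤ suc m
  ℓ≤1+m = ℕₚ.m≤n⇒m≤1+n (subst (ℓ ≤_) (lastBlock+ℓ d) (ℕₚ.m≤n+m ℓ (lastBlock d)))

HasCode : ∀ {k ℓ} → (Fin k → ℕ) → FacetData k ℓ → Set
HasCode w d = ∀ i → code d i ≡ w i

extensions-cover : ∀ {m ℓ} b (ds : List (FacetData (suc m) ℓ)) (w : Fin (suc (suc m)) → ℕ) →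
  w Fin.zero < suc (suc m) ∸ (eqCount b + ℓ) →
  Any (λ e → ∀ c → relabel b (w Fin.zero) (code e c) ≡ w (Fin.suc c)) ds →
  Any (HasCode w) (extensions b ds)
extensions-cover b ds w w₀<K tailCode =
  gridMap-any (extend b) _ ds (Any.map (λ {e} h → w Fin.zero , w₀<K , hasCode e h) tailCode)
  where
  hasCode : ∀ e → (∀ c → relabel b (w Fin.zero) (code e c) ≡ w (Fin.suc c)) → HasCode w (extend b (w Fin.zero) e)
  hasCode e h Fin.zero    = code-extend-zero b (w Fin.zero) e (extension-block-bound b e _ w₀<K)
  hasCode e h (Fin.suc c) = trans (code-extend-suc b (w Fin.zero) e c) (h c)

DistinctCodes : ∀ {k ℓ} → FacetData k ℓ → FacetData k ℓ → Set
DistinctCodes d e = ¬ (∀ i → code d i ≡ code e i)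

-- Extensions of data with pairwise distinct codes have pairwise distinct codes:
-- the code determines a through coordinate 0 and d through the others.
extensions-distinct : ∀ {m ℓ} b (ds : List (FacetData (suc m) ℓ)) →
  AllPairs DistinctCodes ds → AllPairs DistinctCodes (extensions b ds)
extensions-distinct {m} {ℓ} b ds distinct = gridMap-allPairs (extend b) K ds distinct differentBlock differentData
  where
  K = suc (suc m) ∸ (eqCount b + ℓ)
  code₀ : ∀ d a → a < K → code (extend b a d) Fin.zero ≡ a
  code₀ d a a<K = code-extend-zero b a d (extension-block-bound b d a a<K)
  differentBlock : ∀ d a a′ → a < a′ → a′ < K → DistinctCodes (extend b a d) (extend b a′ d)
  differentBlock d a a′ a<a′ a′<K same =
    ℕₚ.<-irrefl (trans (sym (code₀ d a (ℕₚ.<-trans a<a′ a′<K))) (trans (same Fin.zero) (code₀ d a′ a′<K))) a<a′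
  differentData : ∀ d e → DistinctCodes d e → ∀ a a′ → a < K → a′ < K → DistinctCodes (extend b a d) (extend b a′ e)
  differentData d e d≠e a a′ a<K a′<K same with a ≟ a′
  ... | yes refl = d≠e (λ c → relabel-injective b a _ _
          (trans (sym (code-extend-suc b a d c)) (trans (same (Fin.suc c)) (code-extend-suc b a e c))))
  ... | no  a≢a′ = a≢a′ (trans (sym (code₀ d a a<K)) (trans (same Fin.zero) (code₀ e a′ a′<K)))

SharesFirstBlock : ∀ {m ℓ} → FacetData (suc (suc m)) ℓ → Set
SharesFirstBlock d = ∃ λ c → code d (Fin.suc c) ≡ code d Fin.zero

sharing-respects-code : ∀ {m ℓ} {d e : FacetData (suc (suc m)) ℓ} →
  SharesFirstBlock d → ¬ SharesFirstBlock e → DistinctCodes d e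
sharing-respects-code (c , shared) notShared same =
  notShared (c , trans (sym (same (Fin.suc c))) (trans shared (same Fin.zero)))

extensions-true-share : ∀ {m ℓ} (ds : List (FacetData (suc m) ℓ)) → All SharesFirstBlock (extensions true ds)
extensions-true-share {m} {ℓ} ds = gridMap-all (extend true) _ ds (All.universal (λ _ → tt) ds) shares
  where
  shares : ∀ d → ⊤ → ∀ a → a < suc m ∸ ℓ → SharesFirstBlock (extend true a d)
  shares d _ a a<K =
    let (c , codeᶜ≡a) = proj₂ (code-surjOnto d) a a<K in
    c , trans (code-extend-suc true a d c)
          (trans (relabel-true a (code d c))
            (trans codeᶜ≡a (sym (code-extend-zero true a d (ℕₚ.≤-pred (subst (a <_) (blockCount d) a<K))))))

extensions-false-alone : ∀ {m ℓ} (ds : List (FacetData (suc m) ℓ)) →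
  All (¬_ ∘ SharesFirstBlock) (extensions false ds)
extensions-false-alone {m} {ℓ} ds = gridMap-all (extend false) _ ds (All.universal (λ _ → tt) ds) alone
  where
  alone : ∀ d → ⊤ → ∀ a → a < suc (suc m) ∸ ℓ → ¬ SharesFirstBlock (extend false a d)
  alone d _ a a<K (c , shared) = relabel-false-≢ a (code d c)
    (trans (sym (code-extend-suc false a d c))
      (trans shared (code-extend-zero false a d (extension-block-bound false d a a<K))))

tail-surjOnto-shared : ∀ {m K} (w : Fin (suc (suc m)) → ℕ) i → w (Fin.suc i) ≡ w Fin.zero →
  IsSurjOnto K w → IsSurjOnto K (w ∘ Fin.suc)
tail-surjOnto-shared w i shared (bounded , onto) = bounded ∘ Fin.suc , onto′
  where
  onto′ : ∀ v → v < _ → ∃ λ j → w (Fin.suc j) ≡ v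
  onto′ v v<K with onto v v<K
  ... | Fin.zero  , w₀≡v = i , trans shared w₀≡v
  ... | Fin.suc j , wⱼ≡v = j , wⱼ≡v

tail-surjOnto-alone : ∀ {m K} (w : Fin (suc (suc m)) → ℕ) → (∀ i → w (Fin.suc i) ≢ w Fin.zero) →
  IsSurjOnto (suc K) w → IsSurjOnto K (unrelabel (w Fin.zero) ∘ w ∘ Fin.suc)
tail-surjOnto-alone {m} {K} w alone (bounded , onto) = bounded′ , onto′
  where
  a = w Fin.zero
  bounded′ : ∀ c → unrelabel a (w (Fin.suc c)) < K
  bounded′ c with w (Fin.suc c) <? a
  ... | yes wᶜ<a = ℕₚ.<-≤-trans wᶜ<a (ℕₚ.≤-pred (bounded Fin.zero))
  ... | no  wᶜ≮a with w (Fin.suc c) | bounded (Fin.suc c) | alone c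
  ...   | zero  | _         | wᶜ≢a = ⊥-elim (wᶜ≢a (sym (ℕₚ.n≤0⇒n≡0 (ℕₚ.≮⇒≥ wᶜ≮a))))
  ...   | suc v | s≤s v<K   | _    = v<K
  onto′ : ∀ u → u < K → ∃ λ j → unrelabel a (w (Fin.suc j)) ≡ u
  onto′ u u<K with u <? a
  ... | yes u<a with onto u (ℕₚ.m<n⇒m<1+n u<K)
  ...   | Fin.zero  , a≡u = ⊥-elim (ℕₚ.<-irrefl (sym a≡u) u<a)
  ...   | Fin.suc j , wⱼ≡u = j , trans (cong (unrelabel a) wⱼ≡u) (unrelabel-below a u u<a)
  onto′ u u<K | no u≮a with onto (suc u) (s≤s u<K)
  ...   | Fin.zero  , a≡1+u = ⊥-elim (u≮a (subst (u <_) (sym a≡1+u) ℕₚ.≤-refl))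
  ...   | Fin.suc j , wⱼ≡1+u = j , trans (cong (unrelabel a) wⱼ≡1+u)
            (unrelabel-above a (suc u) (λ 1+u<a → u≮a (ℕₚ.<-trans (ℕₚ.n<1+n u) 1+u<a)))

surjOnto⇒≤ : ∀ {k K} (w : Fin k → ℕ) → IsSurjOnto K w → K ≤ k
surjOnto⇒≤ {k} {K} w (_ , onto) = Finₚ.injective⇒≤ {f = preimage} injective
  where
  preimage : Fin K → Fin k
  preimage v = proj₁ (onto (toℕ v) (Finₚ.toℕ<n v))
  injective : ∀ {u v} → preimage u ≡ preimage v → u ≡ v
  injective {u} {v} eq = Finₚ.toℕ-injective
    (trans (sym (proj₂ (onto (toℕ u) (Finₚ.toℕ<n u))))
      (trans (cong w eq) (proj₂ (onto (toℕ v) (Finₚ.toℕ<n v)))))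

pointDatum : FacetData 1 0
pointDatum = facet idPerm [] refl refl

-- Representatives of all facets with ℓ equalities on m + 1 coordinates: the new
-- coordinate 0 either joins an existing block or forms a block on its own.
facetList : (m ℓ : ℕ) → List (FacetData (suc m) ℓ)
facetList zero    zero    = pointDatum ∷ []
facetList zero    (suc ℓ) = []
facetList (suc m) zero    = extensions false (facetList m zero)
facetList (suc m) (suc ℓ) = extensions true (facetList m ℓ) ++ extensions false (facetList m (suc ℓ))

facetCount : ℕ → ℕ → ℕ
facetCount m ℓ = length (facetList m ℓ)

delay : {A : Set} → A → (ℕ → A) → ℕ → A
delay z f zero    = z
delay z f (suc ℓ) = f ℓ

facetCount-rec : ∀ m ℓ → facetCount (suc m) ℓ ≡ (suc (suc m) ∸ ℓ) * (delay 0 (facetCount m) ℓ + facetCount m ℓ)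
facetCount-rec m zero    = length-gridMap (extend false) (suc (suc m)) (facetList m zero)
facetCount-rec m (suc ℓ) = begin
  length (extensions true (facetList m ℓ) ++ extensions false (facetList m (suc ℓ)))
    ≡⟨ Listₚ.length-++ (extensions true (facetList m ℓ)) ⟩
  length (extensions true (facetList m ℓ)) + length (extensions false (facetList m (suc ℓ)))
    ≡⟨ cong₂ _+_ (length-gridMap (extend true) K (facetList m ℓ)) (length-gridMap (extend false) K (facetList m (suc ℓ))) ⟩
  K * facetCount m ℓ + K * facetCount m (suc ℓ)
    ≡⟨ ℕₚ.*-distribˡ-+ K (facetCount m ℓ) (facetCount m (suc ℓ)) ⟨
  K * (facetCount m ℓ + facetCount m (suc ℓ)) ∎
  where
  open ≡-Reasoning
  K = suc m ∸ ℓ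

facetCount-vanish : ∀ m → facetCount m (suc m) ≡ 0
facetCount-vanish m with facetList m (suc m)
... | []    = refl
... | d ∷ _ = ⊥-elim (ℕₚ.<-irrefl refl
                (ℕₚ.≤-trans (ℕₚ.m≤n+m (suc m) (lastBlock d)) (ℕₚ.≤-reflexive (lastBlock+ℓ d))))

facetList-covers : ∀ m ℓ (w : Fin (suc m) → ℕ) → IsSurjOnto (suc m ∸ ℓ) w → Any (HasCode w) (facetList m ℓ)
facetList-covers zero zero    w (bounded , _) = here (λ { Fin.zero → sym (ℕₚ.n<1⇒n≡0 (bounded Fin.zero)) })
facetList-covers zero (suc ℓ) w (bounded , _) =
  ⊥-elim (ℕₚ.n≮0 (subst (w Fin.zero <_) (ℕₚ.0∸n≡0 ℓ) (bounded Fin.zero)))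
facetList-covers (suc m) ℓ w onto with Finₚ.any? (λ i → w (Fin.suc i) ≟ w Fin.zero)
... | yes (i , shared) = joined ℓ onto
  where
  joined : ∀ ℓ → IsSurjOnto (suc (suc m) ∸ ℓ) w → Any (HasCode w) (facetList (suc m) ℓ)
  joined zero onto = ⊥-elim (ℕₚ.<-irrefl refl (surjOnto⇒≤ (w ∘ Fin.suc) (tail-surjOnto-shared w i shared onto)))
  joined (suc ℓ) onto = Anyₚ.++⁺ˡ (extensions-cover true (facetList m ℓ) w (proj₁ onto Fin.zero)
    (Any.map (λ h c → trans (relabel-true (w Fin.zero) _) (h c))
      (facetList-covers m ℓ (w ∘ Fin.suc) (tail-surjOnto-shared w i shared onto))))
... | no notShared = inNewPart ℓ (extensions-cover false (facetList m ℓ) w (proj₁ onto Fin.zero)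
      (Any.map (λ h c → trans (cong (relabel false a) (h c)) (relabel-unrelabel a _ (alone c)))
        (facetList-covers m ℓ w′ (tail-surjOnto-alone w alone (subst (λ K → IsSurjOnto K w) K≡ onto)))))
  where
  a = w Fin.zero
  w′ = unrelabel a ∘ w ∘ Fin.suc
  alone : ∀ i → w (Fin.suc i) ≢ a
  alone i eq = notShared (i , eq)
  ℓ≤1+m : ℓ ≤ suc m
  ℓ≤1+m = ℕₚ.≮⇒≥ (λ 1+m<ℓ → ℕₚ.n≮0 (subst (a <_) (ℕₚ.m≤n⇒m∸n≡0 1+m<ℓ) (proj₁ onto Fin.zero)))
  K≡ : suc (suc m) ∸ ℓ ≡ suc (suc m ∸ ℓ)
  K≡ = ℕₚ.+-∸-assoc 1 ℓ≤1+m
  inNewPart : ∀ ℓ → Any (HasCode w) (extensions false (facetList m ℓ)) → Any (HasCode w) (facetList (suc m) ℓ)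
  inNewPart zero    any = any
  inNewPart (suc ℓ) any = Anyₚ.++⁺ʳ (extensions true (facetList m ℓ)) any

facetList-distinct : ∀ m ℓ → AllPairs DistinctCodes (facetList m ℓ)
facetList-distinct zero    zero    = [] ∷ []
facetList-distinct zero    (suc ℓ) = []
facetList-distinct (suc m) zero    = extensions-distinct false (facetList m zero) (facetList-distinct m zero)
facetList-distinct (suc m) (suc ℓ) =
  AllPairsₚ.++⁺ (extensions-distinct true  (facetList m ℓ)       (facetList-distinct m ℓ))
                (extensions-distinct false (facetList m (suc ℓ)) (facetList-distinct m (suc ℓ)))
                (All.map (λ {d} shares → All.map (λ {e} → sharing-respects-code {d = d} {e = e} shares)
                                           (extensions-false-alone (facetList m (suc ℓ))))
                         (extensions-true-share (facetList m ℓ)))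

facetList-isFacetCount : ∀ {N : ℚ} → 0ℚ <ℚ N → ∀ m ℓ → IsFacetCount N (suc m) ℓ (facetCount m ℓ)
facetList-isFacetCount {N} N>0 m ℓ =
  facetList m ℓ , refl ,
  AllPairs.map (λ {d} {e} d≠e same → d≠e (sameFacet⇒sameCode N>0 d e same)) (facetList-distinct m ℓ) ,
  λ d → Any.map (λ {e} h → sameCode⇒sameFacet N d e (λ i → sym (h i)))
                (facetList-covers m ℓ (code d) (code-surjOnto d))

module ClassCount {A : Set} (_∼_ : A → A → Set)
  (∼-sym : ∀ x y → x ∼ y → y ∼ x) (∼-trans : ∀ x y z → x ∼ y → y ∼ z → x ∼ z) where

  Inequivalent : List A → Set
  Inequivalent = AllPairs (λ x y → ¬ x ∼ y)

  Covering : List A → Set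
  Covering es = ∀ x → Any (x ∼_) es

  private
    lookup-all : ∀ {P : A → Set} {xs} → All P xs → ∀ i → P (lookup xs i)
    lookup-all (px ∷ _)   Fin.zero    = px
    lookup-all (_  ∷ pxs) (Fin.suc i) = lookup-all pxs i

    lookup-inequivalent : ∀ {xs} → Inequivalent xs → ∀ i j → toℕ i < toℕ j → ¬ lookup xs i ∼ lookup xs j
    lookup-inequivalent (px ∷ _)   Fin.zero    (Fin.suc j) _         = lookup-all px j
    lookup-inequivalent (_  ∷ pxs) (Fin.suc i) (Fin.suc j) (s≤s i<j) = lookup-inequivalent pxs i j i<j

  -- Sending each element of ds to the position of an equivalent element of es
  -- is injective, as distinct elements of ds are inequivalent.
  inequivalent-≤-covering : ∀ ds es → Inequivalent ds → Covering es → length ds ≤ length es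
  inequivalent-≤-covering ds es inequivalent covering = Finₚ.injective⇒≤ {f = match} injective
    where
    match : Fin (length ds) → Fin (length es)
    match i = Any.index (covering (lookup ds i))
    matched : ∀ i → lookup ds i ∼ lookup es (match i)
    matched i = Anyₚ.lookup-index (covering (lookup ds i))
    equivalent : ∀ i j → match i ≡ match j → lookup ds i ∼ lookup ds j
    equivalent i j eq = ∼-trans _ _ _ (matched i)
      (∼-sym _ _ (subst (λ k → lookup ds j ∼ lookup es k) (sym eq) (matched j)))
    injective : ∀ {i j} → match i ≡ match j → i ≡ j
    injective {i} {j} eq with Finₚ.<-cmp i j
    ... | tri< i<j _   _   = ⊥-elim (lookup-inequivalent inequivalent i j i<j (equivalent i j eq))
    ... | tri≈ _   i≡j _   = i≡j
    ... | tri> _   _   j<i = ⊥-elim (lookup-inequivalent inequivalent j i j<i (equivalent j i (sym eq)))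

  representatives-length : ∀ ds es → Inequivalent ds → Covering ds → Inequivalent es → Covering es →
    length ds ≡ length es
  representatives-length ds es ineq-ds cov-ds ineq-es cov-es =
    ℕₚ.≤-antisym (inequivalent-≤-covering ds es ineq-ds cov-es) (inequivalent-≤-covering es ds ineq-es cov-ds)

facetCount-unique : ∀ {N : ℚ} → 0ℚ <ℚ N → ∀ m ℓ c → IsFacetCount N (suc m) ℓ c → c ≡ facetCount m ℓ
facetCount-unique {N} N>0 m ℓ c (ds , length≡c , inequivalent , covering) =
  let (_ , _ , inequivalent′ , covering′) = facetList-isFacetCount N>0 m ℓ in
  trans (sym length≡c) (representatives-length ds (facetList m ℓ) inequivalent covering inequivalent′ covering′)
  where
  open ClassCount (SameFacet {suc m} {ℓ} N)
    (λ d e → sameFacet-sym {d = d} {e = e}) (λ d e f → sameFacet-trans {d = d} {e = e} {f = f})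

absorption : ∀ N k → suc k * (suc N C suc k) ≡ suc N * (N C k)
absorption zero    zero    = refl
absorption zero    (suc k) = ℕₚ.*-zeroʳ (suc (suc k))
absorption (suc N) zero    = trans (ℕₚ.+-identityʳ _) (trans (nC1≡n (suc (suc N))) (sym (ℕₚ.*-identityʳ (suc (suc N)))))
absorption (suc N) (suc k) = begin
  suc (suc k) * (suc n C suc (suc k))   ≡⟨ cong (suc (suc k) *_) (nCk+nC[k+1]≡[n+1]C[k+1] n (suc k)) ⟨
  suc (suc k) * (x + y)                 ≡⟨ ℕₚ.*-distribˡ-+ (suc (suc k)) x y ⟩
  (x + suc k * x) + suc (suc k) * y     ≡⟨ cong₂ (λ u v → (x + u) + v) (absorption N k) (absorption N (suc k)) ⟩
  (x + n * (N C k)) + n * (N C suc k)   ≡⟨ ℕₚ.+-assoc x (n * (N C k)) (n * (N C suc k)) ⟩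
  x + (n * (N C k) + n * (N C suc k))   ≡⟨ cong (λ u → x + u) (ℕₚ.*-distribˡ-+ n (N C k) (N C suc k)) ⟨
  x + n * ((N C k) + (N C suc k))       ≡⟨ cong (λ u → x + n * u) (nCk+nC[k+1]≡[n+1]C[k+1] N k) ⟩
  suc n * x                             ∎
  where
  open ≡-Reasoning
  n = suc N
  x = n C suc k
  y = n C suc (suc k)

figurate-step : ∀ n₀ k → suc k * F (suc k) (suc n₀) ≡ suc n₀ * F k (suc n₀) + k * F k (suc n₀)
figurate-step n₀ k = begin
  suc k * ((n₀ + suc k) C suc k)   ≡⟨ cong (λ z → suc k * (z C suc k)) (ℕₚ.+-suc n₀ k) ⟩
  suc k * (suc (n₀ + k) C suc k)   ≡⟨ absorption (n₀ + k) k ⟩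
  (suc n₀ + k) * F k (suc n₀)      ≡⟨ ℕₚ.*-distribʳ-+ (F k (suc n₀)) (suc n₀) k ⟩
  suc n₀ * F k (suc n₀) + k * F k (suc n₀) ∎
  where open ≡-Reasoning

Σ< : ℕ → (ℕ → ℤ) → ℤ
Σ< L f = foldr ℤ._+_ (+ 0) (applyUpTo f L)

Σ<-cong : ∀ L (f g : ℕ → ℤ) → (∀ ℓ → ℓ < L → f ℓ ≡ g ℓ) → Σ< L f ≡ Σ< L g
Σ<-cong zero    f g f≗g = refl
Σ<-cong (suc L) f g f≗g =
  cong₂ ℤ._+_ (f≗g 0 (s≤s z≤n)) (Σ<-cong L (f ∘ suc) (g ∘ suc) (λ ℓ ℓ<L → f≗g (suc ℓ) (s≤s ℓ<L)))

Σ<-scale : ∀ L k (f : ℕ → ℤ) → k ℤ.* Σ< L f ≡ Σ< L (λ ℓ → k ℤ.* f ℓ)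
Σ<-scale zero    k f = ℤₚ.*-zeroʳ k
Σ<-scale (suc L) k f =
  trans (ℤₚ.*-distribˡ-+ k (f 0) (Σ< L (f ∘ suc))) (cong (λ z → k ℤ.* f 0 ℤ.+ z) (Σ<-scale L k (f ∘ suc)))

Σ<-snoc : ∀ L (f : ℕ → ℤ) → Σ< (suc L) f ≡ Σ< L f ℤ.+ f L
Σ<-snoc zero    f = ℤₚ.+-comm (f 0) (+ 0)
Σ<-snoc (suc L) f =
  trans (cong (λ z → f 0 ℤ.+ z) (Σ<-snoc L (f ∘ suc))) (sym (ℤₚ.+-assoc (f 0) (Σ< L (f ∘ suc)) (f (suc L))))

summation-by-parts : ∀ L (a B : ℕ → ℤ) →
  Σ< L (λ ℓ → a ℓ ℤ.* (B ℓ ℤ.- B (suc ℓ))) ℤ.+ a L ℤ.* B L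
    ≡ Σ< (suc L) (λ ℓ → (a ℓ ℤ.- delay (+ 0) a ℓ) ℤ.* B ℓ)
summation-by-parts zero    a B = base (a 0) (B 0)
  where
  base : ∀ a₀ B₀ → + 0 ℤ.+ a₀ ℤ.* B₀ ≡ (a₀ ℤ.- + 0) ℤ.* B₀ ℤ.+ + 0
  base = solve-∀
summation-by-parts (suc L) a B = begin
  Σ< (suc L) g ℤ.+ a (suc L) ℤ.* B (suc L)
    ≡⟨ cong (ℤ._+ a (suc L) ℤ.* B (suc L)) (Σ<-snoc L g) ⟩
  (Σ< L g ℤ.+ g L) ℤ.+ a (suc L) ℤ.* B (suc L)
    ≡⟨ regroup (Σ< L g) (a L) (a (suc L)) (B L) (B (suc L)) ⟩
  (Σ< L g ℤ.+ a L ℤ.* B L) ℤ.+ (a (suc L) ℤ.- a L) ℤ.* B (suc L)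
    ≡⟨ cong (ℤ._+ (a (suc L) ℤ.- a L) ℤ.* B (suc L)) (summation-by-parts L a B) ⟩
  Σ< (suc L) h ℤ.+ h (suc L)
    ≡⟨ Σ<-snoc (suc L) h ⟨
  Σ< (suc (suc L)) h ∎
  where
  open ≡-Reasoning
  g h : ℕ → ℤ
  g ℓ = a ℓ ℤ.* (B ℓ ℤ.- B (suc ℓ))
  h ℓ = (a ℓ ℤ.- delay (+ 0) a ℓ) ℤ.* B ℓ
  regroup : ∀ X a₀ a₁ B₀ B₁ →
    (X ℤ.+ a₀ ℤ.* (B₀ ℤ.- B₁)) ℤ.+ a₁ ℤ.* B₁ ≡ (X ℤ.+ a₀ ℤ.* B₀) ℤ.+ (a₁ ℤ.- a₀) ℤ.* B₁
  regroup = solve-∀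

sign : ℕ → ℤ
sign ℓ = (ℤ.- ℤ.1ℤ) ℤ.^ ℓ

altSum≡Σ< : ∀ c n p → altSum c n p ≡ Σ< p (λ ℓ → sign ℓ ℤ.* + (c ℓ * F (p ∸ ℓ) n))
altSum≡Σ< c n p = cong (foldr ℤ._+_ (+ 0)) (Listₚ.map-upTo _ p)

-- Writing A_k = k F^k_n, the
-- figurate step gives n F^k_n = A_{k+1} - A_k; multiplying row m by n and
-- summing by parts produces exactly row m + 1 of the recurrence.
module PowerIdentity (c : ℕ → ℕ → ℕ)
  (c-base   : c 0 0 ≡ 1)
  (c-vanish : ∀ m → c m (suc m) ≡ 0)
  (c-rec    : ∀ m ℓ → c (suc m) ℓ ≡ (suc (suc m) ∸ ℓ) * (delay 0 (c m) ℓ + c m ℓ))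
  (n₀ : ℕ) where

  n : ℕ
  n = suc n₀

  G A : ℕ → ℕ
  G k = F k n
  A k = k * G k

  A-step : ∀ k → + A (suc k) ≡ + n ℤ.* + G k ℤ.+ + A k
  A-step k = begin
    + A (suc k)               ≡⟨ cong +_ (figurate-step n₀ k) ⟩
    + (n * G k + A k)         ≡⟨ ℤₚ.pos-+ (n * G k) (A k) ⟩
    + (n * G k) ℤ.+ + A k     ≡⟨ cong (ℤ._+ + A k) (ℤₚ.pos-* n (G k)) ⟩
    + n ℤ.* + G k ℤ.+ + A k   ∎
    where open ≡-Reasoning

  term : ℕ → ℕ → ℤ
  term m ℓ = sign ℓ ℤ.* + (c m ℓ * G (suc m ∸ ℓ))

  S : ℕ → ℤ
  S m = Σ< (suc m) (term m)

  coeff level : ℕ → ℕ → ℤ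
  coeff m ℓ = sign ℓ ℤ.* + c m ℓ
  level m ℓ = + A (suc (suc m) ∸ ℓ)

  n*term : ∀ m ℓ → ℓ ≤ m → + n ℤ.* term m ℓ ≡ coeff m ℓ ℤ.* (level m ℓ ℤ.- level m (suc ℓ))
  n*term m ℓ ℓ≤m = begin
    + n ℤ.* (sign ℓ ℤ.* + (c m ℓ * G k))
      ≡⟨ cong (λ z → + n ℤ.* (sign ℓ ℤ.* z)) (ℤₚ.pos-* (c m ℓ) (G k)) ⟩
    + n ℤ.* (sign ℓ ℤ.* (+ c m ℓ ℤ.* + G k))
      ≡⟨ ring (+ n) (sign ℓ) (+ c m ℓ) (+ G k) (+ A k) ⟩
    coeff m ℓ ℤ.* ((+ n ℤ.* + G k ℤ.+ + A k) ℤ.- + A k)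
      ≡⟨ cong (λ z → coeff m ℓ ℤ.* (z ℤ.- + A k)) (A-step k) ⟨
    coeff m ℓ ℤ.* (+ A (suc k) ℤ.- + A k)
      ≡⟨ cong (λ z → coeff m ℓ ℤ.* (+ A z ℤ.- + A k)) (ℕₚ.+-∸-assoc 1 (ℕₚ.m≤n⇒m≤1+n ℓ≤m)) ⟨
    coeff m ℓ ℤ.* (level m ℓ ℤ.- level m (suc ℓ)) ∎
    where
    open ≡-Reasoning
    k = suc m ∸ ℓ
    ring : ∀ n s c g a → n ℤ.* (s ℤ.* (c ℤ.* g)) ≡ (s ℤ.* c) ℤ.* ((n ℤ.* g ℤ.+ a) ℤ.- a)
    ring = solve-∀

  delay-coeff : ∀ m ℓ → delay (+ 0) (coeff m) ℓ ≡ ℤ.- (sign ℓ ℤ.* + delay 0 (c m) ℓ)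
  delay-coeff m zero    = refl
  delay-coeff m (suc ℓ) = ring (sign ℓ) (+ c m ℓ)
    where
    ring : ∀ s x → s ℤ.* x ≡ ℤ.- ((ℤ.- ℤ.1ℤ ℤ.* s) ℤ.* x)
    ring = solve-∀

  regrouped-term : ∀ m ℓ → (coeff m ℓ ℤ.- delay (+ 0) (coeff m) ℓ) ℤ.* level m ℓ ≡ term (suc m) ℓ
  regrouped-term m ℓ = begin
    (coeff m ℓ ℤ.- delay (+ 0) (coeff m) ℓ) ℤ.* + A K
      ≡⟨ cong (λ z → (coeff m ℓ ℤ.- z) ℤ.* + A K) (delay-coeff m ℓ) ⟩
    (sign ℓ ℤ.* + x ℤ.- ℤ.- (sign ℓ ℤ.* + d)) ℤ.* + A K
      ≡⟨ ring (sign ℓ) (+ d) (+ x) (+ A K) ⟩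
    sign ℓ ℤ.* ((+ d ℤ.+ + x) ℤ.* + A K)
      ≡⟨ cong (λ z → sign ℓ ℤ.* (z ℤ.* + A K)) (ℤₚ.pos-+ d x) ⟨
    sign ℓ ℤ.* (+ (d + x) ℤ.* + A K)
      ≡⟨ cong (sign ℓ ℤ.*_) (ℤₚ.pos-* (d + x) (A K)) ⟨
    sign ℓ ℤ.* + ((d + x) * (K * G K))
      ≡⟨ cong (λ z → sign ℓ ℤ.* + z) (ℕₚ.*-assoc (d + x) K (G K)) ⟨
    sign ℓ ℤ.* + (((d + x) * K) * G K)
      ≡⟨ cong (λ z → sign ℓ ℤ.* + (z * G K)) (trans (ℕₚ.*-comm (d + x) K) (sym (c-rec m ℓ))) ⟩
    term (suc m) ℓ ∎
    where
    open ≡-Reasoning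
    K = suc (suc m) ∸ ℓ
    d = delay 0 (c m) ℓ
    x = c m ℓ
    ring : ∀ s d x a → (s ℤ.* x ℤ.- ℤ.- (s ℤ.* d)) ℤ.* a ≡ s ℤ.* ((d ℤ.+ x) ℤ.* a)
    ring = solve-∀

  S-step : ∀ m → + n ℤ.* S m ≡ S (suc m)
  S-step m = begin
    + n ℤ.* S m
      ≡⟨ Σ<-scale (suc m) (+ n) (term m) ⟩
    Σ< (suc m) (λ ℓ → + n ℤ.* term m ℓ)
      ≡⟨ Σ<-cong (suc m) _ _ (λ ℓ ℓ<1+m → n*term m ℓ (ℕₚ.≤-pred ℓ<1+m)) ⟩
    Σ< (suc m) differences
      ≡⟨ ℤₚ.+-identityʳ (Σ< (suc m) differences) ⟨
    Σ< (suc m) differences ℤ.+ + 0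
      ≡⟨ cong (λ z → Σ< (suc m) differences ℤ.+ z ℤ.* level m (suc m)) last-coeff ⟨
    Σ< (suc m) differences ℤ.+ coeff m (suc m) ℤ.* level m (suc m)
      ≡⟨ summation-by-parts (suc m) (coeff m) (level m) ⟩
    Σ< (suc (suc m)) (λ ℓ → (coeff m ℓ ℤ.- delay (+ 0) (coeff m) ℓ) ℤ.* level m ℓ)
      ≡⟨ Σ<-cong (suc (suc m)) _ _ (λ ℓ _ → regrouped-term m ℓ) ⟩
    S (suc m) ∎
    where
    open ≡-Reasoning
    differences : ℕ → ℤ
    differences ℓ = coeff m ℓ ℤ.* (level m ℓ ℤ.- level m (suc ℓ))
    last-coeff : coeff m (suc m) ≡ + 0
    last-coeff = trans (cong (λ z → sign (suc m) ℤ.* + z) (c-vanish m)) (ℤₚ.*-zeroʳ (sign (suc m)))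

  S-base : S 0 ≡ + n
  S-base = begin
    ℤ.1ℤ ℤ.* + (c 0 0 * G 1) ℤ.+ + 0  ≡⟨ ℤₚ.+-identityʳ _ ⟩
    ℤ.1ℤ ℤ.* + (c 0 0 * G 1)          ≡⟨ ℤₚ.*-identityˡ _ ⟩
    + (c 0 0 * G 1)                   ≡⟨ cong (λ z → + (z * G 1)) c-base ⟩
    + (1 * G 1)                       ≡⟨ cong +_ (ℕₚ.*-identityˡ (G 1)) ⟩
    + G 1                             ≡⟨ cong +_ (trans (nC1≡n (n₀ + 1)) (ℕₚ.+-comm n₀ 1)) ⟩
    + n                               ∎
    where open ≡-Reasoning

  power≡S : ∀ m → + (n ^ suc m) ≡ S m
  power≡S zero    = trans (cong +_ (ℕₚ.*-identityʳ n)) (sym S-base)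
  power≡S (suc m) = trans (ℤₚ.pos-* n (n ^ suc m)) (trans (cong (+ n ℤ.*_) (power≡S m)) (S-step m))

  power≡altSum : ∀ m → + (n ^ suc m) ≡ altSum (c m) n (suc m)
  power≡altSum m = trans (power≡S m) (sym (altSum≡Σ< (c m) n (suc m)))

altSum-cong : ∀ (c c′ : ℕ → ℕ) n p → (∀ ℓ → ℓ < p → c ℓ ≡ c′ ℓ) → altSum c n p ≡ altSum c′ n p
altSum-cong c c′ n p c≗c′ = begin
  altSum c n p                                          ≡⟨ altSum≡Σ< c n p ⟩
  Σ< p (λ ℓ → sign ℓ ℤ.* + (c ℓ * F (p ∸ ℓ) n))         ≡⟨ Σ<-cong p _ _ (λ ℓ ℓ<p → cong (λ z → sign ℓ ℤ.* + (z * F (p ∸ ℓ) n)) (c≗c′ ℓ ℓ<p)) ⟩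
  Σ< p (λ ℓ → sign ℓ ℤ.* + (c′ ℓ * F (p ∸ ℓ) n))        ≡⟨ altSum≡Σ< c′ n p ⟨
  altSum c′ n p                                         ∎
  where open ≡-Reasoning

-- The facet counts exist (the explicit list), and any facet counts c satisfy the
-- identity: they agree with the explicit counts, which obey the recurrence.
mainTheorem1 : (n p : ℕ) → 0 < n → 0 < p → (N : ℚ) → 0ℚ <ℚ N →
    (Σ (ℕ → ℕ) λ c → (ℓ : ℕ) → ℓ < p → IsFacetCount N p ℓ (c ℓ))
    × ((c : ℕ → ℕ) → ((ℓ : ℕ) → ℓ < p → IsFacetCount N p ℓ (c ℓ)) →
    + (n ^ p) ≡ altSum c n p)
mainTheorem1 (suc n₀) (suc m) _ _ N N>0 = (facetCount m , λ ℓ _ → facetList-isFacetCount N>0 m ℓ) , identity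
  where
  open PowerIdentity facetCount refl facetCount-vanish facetCount-rec n₀ using (power≡altSum)
  identity : (c : ℕ → ℕ) → (∀ ℓ → ℓ < suc m → IsFacetCount N (suc m) ℓ (c ℓ)) →
    + (suc n₀ ^ suc m) ≡ altSum c (suc n₀) (suc m)
  identity c isCount = trans (power≡altSum m)
    (altSum-cong (facetCount m) c (suc n₀) (suc m) (λ ℓ ℓ<p → sym (facetCount-unique N>0 m ℓ (c ℓ) (isCount ℓ ℓ<p))))
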